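{- Let $G=(V,E)$ be a simple, connected, undirected graph with $m$ edges, let $\tau$ and $\tau_0$ be spanning trees of $G$, both rooted at the same node $r$, and for each $u\neq r$ let $\mathcal{P}_u$ be the path from $u$ to $r$ in $\tau_0$ (directed towards $r$). For $v\neq r$ let $p(v)$ denote the parent of $v$ in $\tau$. Then $$\sum_{u\neq r}\ \sum_{T_1\cup T_2\in\mathbb{F}^{\mathcal{P}_u}(\tau)}\mathrm{vol}(T_1)=\sum_{\substack{v\neq r:\ p(v)\text{ is the parent of }v\text{ in }\tau_0}}\ \sum_{u\in S_1(v)}\big(2m-\mathrm{vol}(Sub(\tau,v))\big),$$ $$\sum_{u\neq r}\ \sum_{T_1\cup T_2\in\mathbb{F}^{\mathcal{P}_u'}(\tau)}\mathrm{vol}(T_1)=\sum_{\substack{v\neq r:\ v\text{ is the parent of }p(v)\text{ in }\tau_0}}\ \sum_{u\in S_2(v)}\big(2m-\mathrm{vol}(Sub(\tau,v))\big),$$ where $S_1(v)=Sub(\tau,v)\cap Sub(\tau_0,v)$ and $S_2(v)=Sub(\tau,v)\cap Sub(\tau_0,p(v))$.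
   Context: $d(v)$ is the degree of $v$ in $G$, $\mathrm{vol}(S)=\sum_{v\in S}d(v)$, and $Sub(\tau,v)$ is the node set of the subtree rooted at $v$ in the tree $\tau$ rooted at $r$. A 2-forest is a spanning forest with exactly two trees, written $T_1\cup T_2$ with $T_1$ the node set of the tree containing $r$. For a simple directed path $\mathcal{P}$ from $u$ to $r$ and spanning tree $\tau$ with $\mathcal{P}^{(\tau)}_{u\to r}$ the unique $u$-to-$r$ path in $\tau$ (edges directed towards $r$): $\mathbb{F}^{\mathcal{P}}(\tau)=\{\tau\setminus\{i,j\}: (i,j)\in\mathcal{P},\ (i,j)\in\mathcal{P}^{(\tau)}_{u\to r}\}$ and $\mathbb{F}^{\mathcal{P}'}(\tau)=\{\tau\setminus\{i,j\}: (i,j)\in\mathcal{P},\ (j,i)\in\mathcal{P}^{(\tau)}_{u\to r}\}$, membership referring to directed edges along the paths. -}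

module Defs where

open import Data.Nat using (ℕ; zero; suc; _+_; _*_; _∸_; _<ᵇ_)
open import Data.Fin using (Fin; _≟_; toℕ)
open import Data.Bool using (Bool; true; false; _∧_; _∨_; not; if_then_else_)
open import Data.List using (List; map; allFin; upTo)
open import Data.Nat.ListAction using (sum)
open import Data.Bool.ListAction using (any)
open import Data.Product using (_×_; ∃)
open import Relation.Binary.PropositionalEquality using (_≡_; _≢_)
open import Relation.Nullary.Decidable using (⌊_⌋)

Adj : ℕ → Set
Adj n = Fin n → Fin n → Bool

module _ {n : ℕ} where

  _==_ : Fin n → Fin n → Bool
  a == b = ⌊ a ≟ b ⌋

  sumV : (Fin n → ℕ) → ℕ
  sumV f = sum (map f (allFin n))

  anyV : (Fin n → Bool) → Bool
  anyV p = any p (allFin n)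

  countV : (Fin n → Bool) → ℕ
  countV p = sumV (λ x → if p x then 1 else 0)

  SimpleGraph : Adj n → Set
  SimpleGraph adj = (∀ a b → adj a b ≡ adj b a) × (∀ a → adj a a ≡ false)

  data Walk (adj : Adj n) : Fin n → Fin n → Set where
    here : ∀ {a} → Walk adj a a
    step : ∀ {a b c} → adj a b ≡ true → Walk adj b c → Walk adj a c

  Connected : Adj n → Set
  Connected adj = ∀ a b → Walk adj a b

  deg : Adj n → Fin n → ℕ
  deg adj v = countV (adj v)

  numEdges : Adj n → ℕ
  numEdges adj = sumV (λ i → sumV (λ j → if (toℕ i <ᵇ toℕ j) ∧ adj i j then 1 else 0))

  vol : Adj n → (Fin n → Bool) → ℕ
  vol adj S = sumV (λ v → if S v then deg adj v else 0)

  iter : (Fin n → Fin n) → ℕ → Fin n → Fin n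
  iter f zero x = x
  iter f (suc k) x = f (iter f k x)

  -- A spanning tree of G rooted at r, given by its parent map par
  -- (par r = r by convention; tree edges are {v, par v} for v ≠ r,
  -- each a G-edge, and every vertex reaches r by following parents).
  RootedSpanningTree : Adj n → Fin n → (Fin n → Fin n) → Set
  RootedSpanningTree adj r par =
    (par r ≡ r) × (∀ v → v ≢ r → adj v (par v) ≡ true) × (∀ v → ∃ λ k → iter par k v ≡ r)

  -- u ∈ Sub(τ, v): v is an ancestor-or-self of u in the tree with parent map par
  inSub : (Fin n → Fin n) → Fin n → Fin n → Bool
  inSub par v u = any (λ k → iter par k u == v) (upTo (suc n))

  -- the directed edge (i , j) lies on the path from u to r in the tree
  -- (edges directed towards r)
  onPath : Fin n → (Fin n → Fin n) → Fin n → Fin n → Fin n → Bool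
  onPath r par u i j = not (i == r) ∧ (par i == j) ∧ inSub par i u

  treeEdge : Fin n → (Fin n → Fin n) → Fin n → Fin n → Bool
  treeEdge r par a b = (not (a == r) ∧ (par a == b)) ∨ (not (b == r) ∧ (par b == a))

  forestAdj : Fin n → (Fin n → Fin n) → Fin n → Fin n → Fin n → Fin n → Bool
  forestAdj r par i j a b =
    treeEdge r par a b ∧ not ((a == i ∧ b == j) ∨ (a == j ∧ b == i))

  reachR : Fin n → (Fin n → Fin n) → Fin n → Fin n → ℕ → Fin n → Bool
  reachR r par i j zero w = w == r
  reachR r par i j (suc k) w =
    reachR r par i j k w ∨ anyV (λ x → forestAdj r par i j w x ∧ reachR r par i j k x)

  -- T₁ : node set of the tree containing r in the 2-forest τ ∖ {i , j}
  T₁ : Fin n → (Fin n → Fin n) → Fin n → Fin n → Fin n → Bool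
  T₁ r par i j = reachR r par i j n

  -- Σ_{T₁ ∪ T₂ ∈ F^{P_u}(τ)} vol(T₁), where P_u is the τ₀-path from u to r
  sumFP : Adj n → Fin n → (Fin n → Fin n) → (Fin n → Fin n) → Fin n → ℕ
  sumFP adj r par par₀ u =
    sumV (λ i → sumV (λ j →
      if onPath r par₀ u i j ∧ onPath r par u i j then vol adj (T₁ r par i j) else 0))

  -- Σ_{T₁ ∪ T₂ ∈ F^{P_u'}(τ)} vol(T₁)
  sumFP' : Adj n → Fin n → (Fin n → Fin n) → (Fin n → Fin n) → Fin n → ℕ
  sumFP' adj r par par₀ u =
    sumV (λ i → sumV (λ j →
      if onPath r par₀ u i j ∧ onPath r par u j i then vol adj (T₁ r par i j) else 0))

-- Deleting the τ-edge {v, p(v)} (v ≠ r) leaves a 2-forest whose root component is the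
-- complement of Sub(τ, v), so by the handshake lemma vol(T₁) = 2m − vol(Sub(τ, v)).
-- A directed edge (i, j) lies on the τ-path from u to r only if j = p(i), and then exactly
-- when u ∈ Sub(τ, i); likewise (i, p(i)) lies on the τ₀-path from u iff p₀(i) = p(i) and
-- u ∈ Sub(τ₀, i), and (p(j), j) does iff p₀(p(j)) = j and u ∈ Sub(τ₀, p(j)). So each inner
-- double sum collapses to a sum over v ≠ r, and exchanging the sums over u and v gives
-- both identities.
module Submission where

open import Defs
open import Data.Nat using (ℕ; zero; suc; _+_; _*_; _∸_; _≤_; _<_; _≤?_; s≤s; _<ᵇ_)
open import Data.Nat.Properties
  using (+-0-commutativeMonoid; +-identityʳ; m+n∸m≡n; m∸n+n≡m; +-monoʳ-<; ≤-pred; ≤-trans; <⇒≤;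
         n<1+n; ≰⇒>; ≮⇒≥; ≤-antisym; <-asym; <ᵇ-reflects-<)
open import Data.Nat.Induction using (<-wellFounded)
open import Data.Nat.ListAction using (sum)
open import Data.Fin using (Fin; toℕ; _≟_; punchIn)
open import Data.Fin.Properties using (pigeonhole; toℕ<n; toℕ-injective; punchInᵢ≢i)
open import Data.Bool using (Bool; true; false; _∧_; _∨_; not; if_then_else_; T)
open import Data.Bool.Properties using (∧-comm; ∧-zeroʳ; ∧-identityʳ; ∨-zeroʳ; T-∧; T-∨; T-≡)
open import Data.List using (tabulate; map; allFin; upTo)
open import Data.List.Properties using (map-tabulate; map-cong)
open import Data.List.Relation.Unary.Any using (satisfied)
open import Data.List.Relation.Unary.Any.Properties using (any⁺; any⁻)
open import Data.List.Membership.Propositional using (lose)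
open import Data.List.Membership.Propositional.Properties using (∈-allFin; ∈-upTo⁺)
open import Data.Product using (_×_; _,_; ∃; proj₁; proj₂; uncurry)
open import Data.Sum using (_⊎_; inj₁; inj₂)
open import Data.Empty using (⊥-elim)
open import Data.Unit using (tt)
open import Function using (_∘_; id; Equivalence)
open import Induction.WellFounded using (Acc; acc)
open import Relation.Nullary using (¬_; Dec; yes; no; ofʸ; ofⁿ)
open import Relation.Nullary.Decidable using (toWitness; fromWitness; toWitnessFalse; fromWitnessFalse)
open import Relation.Binary.PropositionalEquality using (_≡_; _≢_; refl; sym; trans; cong; cong₂; subst; module ≡-Reasoning)
import Algebra.Properties.CommutativeMonoid.Sum +-0-commutativeMonoid as Fold

open Equivalence using (to; from)
open ≡-Reasoning

module _ {n : ℕ} where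

  sumV≡sum : (f : Fin n → ℕ) → sumV f ≡ Fold.sum f
  sumV≡sum f = trans (cong sum (map-tabulate id f)) (sum-tabulate f)
    where
    sum-tabulate : ∀ {m} (g : Fin m → ℕ) → sum (tabulate g) ≡ Fold.sum g
    sum-tabulate {zero}  g = refl
    sum-tabulate {suc m} g = cong (g Fin.zero +_) (sum-tabulate (g ∘ Fin.suc))

  sumV-cong : {f g : Fin n → ℕ} → (∀ x → f x ≡ g x) → sumV f ≡ sumV g
  sumV-cong f≗g = cong sum (map-cong f≗g (allFin n))

  sumV-zero : sumV {n} (λ _ → 0) ≡ 0
  sumV-zero = trans (sumV≡sum (λ _ → 0)) (Fold.sum-replicate-zero n)

  sumV-distrib-+ : (f g : Fin n → ℕ) → sumV (λ x → f x + g x) ≡ sumV f + sumV g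
  sumV-distrib-+ f g = begin
    sumV (λ x → f x + g x)    ≡⟨ sumV≡sum _ ⟩
    Fold.sum (λ x → f x + g x) ≡⟨ Fold.∑-distrib-+ f g ⟩
    Fold.sum f + Fold.sum g    ≡⟨ sym (cong₂ _+_ (sumV≡sum f) (sumV≡sum g)) ⟩
    sumV f + sumV g            ∎

  sumV-comm : (f : Fin n → Fin n → ℕ) →
    sumV (λ x → sumV (f x)) ≡ sumV (λ y → sumV (λ x → f x y))
  sumV-comm f = begin
    sumV (λ x → sumV (f x))                ≡⟨ nested f ⟩
    Fold.sum (λ x → Fold.sum (f x))        ≡⟨ Fold.∑-comm f ⟩
    Fold.sum (λ y → Fold.sum (λ x → f x y)) ≡⟨ sym (nested (λ y x → f x y)) ⟩
    sumV (λ y → sumV (λ x → f x y))        ∎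
    where
    nested : (g : Fin n → Fin n → ℕ) → sumV (λ x → sumV (g x)) ≡ Fold.sum (λ x → Fold.sum (g x))
    nested g = trans (sumV≡sum _) (Fold.sum-cong-≗ (λ x → sumV≡sum (g x)))

  if-sumV : (b : Bool) (f : Fin n → ℕ) → (if b then sumV f else 0) ≡ sumV (λ x → if b then f x else 0)
  if-sumV true  f = refl
  if-sumV false f = sym sumV-zero

  sumV-regroup : (G : Fin n → Bool) (L : Fin n → Fin n → ℕ) (C : Fin n → Bool) (A : Fin n → Fin n → Bool)
    (x : Fin n → ℕ) → (∀ u v → (if G u then L u v else 0) ≡ (if C v ∧ A v u then x v else 0)) →
    sumV (λ u → if G u then sumV (L u) else 0) ≡ sumV (λ v → if C v then sumV (λ u → if A v u then x v else 0) else 0)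
  sumV-regroup G L C A x term = begin
    sumV (λ u → if G u then sumV (L u) else 0)                       ≡⟨ sumV-cong (λ u → if-sumV (G u) (L u)) ⟩
    sumV (λ u → sumV (λ v → if G u then L u v else 0))                ≡⟨ sumV-cong (λ u → sumV-cong (term u)) ⟩
    sumV (λ u → sumV (λ v → if C v ∧ A v u then x v else 0))          ≡⟨ sumV-comm _ ⟩
    sumV (λ v → sumV (λ u → if C v ∧ A v u then x v else 0))          ≡⟨ sumV-cong (λ v → sym (if-sumV-∧ (C v) (A v) (x v))) ⟩
    sumV (λ v → if C v then sumV (λ u → if A v u then x v else 0) else 0) ∎
    where
    if-sumV-∧ : ∀ c (B : Fin n → Bool) y → (if c then sumV (λ u → if B u then y else 0) else 0) ≡ sumV (λ u → if c ∧ B u then y else 0)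
    if-sumV-∧ true  B y = refl
    if-sumV-∧ false B y = sym sumV-zero

sumV-single : ∀ {n} (f : Fin n → ℕ) (a : Fin n) → (∀ x → x ≢ a → f x ≡ 0) → sumV f ≡ f a
sumV-single {suc n} f a others = begin
  sumV f                           ≡⟨ sumV≡sum f ⟩
  Fold.sum f                       ≡⟨ Fold.sum-remove {i = a} f ⟩
  f a + Fold.sum (f ∘ punchIn a)   ≡⟨ cong (f a +_) (Fold.sum-cong-≗ (λ x → others _ (punchInᵢ≢i a x))) ⟩
  f a + Fold.sum {n} (λ _ → 0)     ≡⟨ cong (f a +_) (Fold.sum-replicate-zero n) ⟩
  f a + 0                          ≡⟨ +-identityʳ (f a) ⟩
  f a                              ∎

if-vanishes : ∀ {b} (x : ℕ) → ¬ T b → (if b then x else 0) ≡ 0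
if-vanishes {false} x _  = refl
if-vanishes {true}  x ¬t = ⊥-elim (¬t tt)

if-cong : ∀ {a b} {x y : ℕ} → a ≡ b → (T b → x ≡ y) → (if a then x else 0) ≡ (if b then y else 0)
if-cong {b = false} refl _   = refl
if-cong {b = true}  refl x≡y = x≡y tt

∧-shuffle : ∀ x y y′ z w → (T x → T y → T y′) → (y′ ∧ y ∧ z) ∧ (x ∧ w) ≡ (x ∧ y) ∧ (w ∧ z)
∧-shuffle false y     y′    z w _ = ∧-zeroʳ _
∧-shuffle true  false y′    z w _ rewrite ∧-zeroʳ y′ = refl
∧-shuffle true  true  false z w h = ⊥-elim (h tt tt)
∧-shuffle true  true  true  z w _ = ∧-comm z w

¬T⇒T-not : ∀ {b} → ¬ T b → T (not b)
¬T⇒T-not {false} _  = tt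
¬T⇒T-not {true}  ¬t = ¬t tt

T-not⇒¬T : ∀ {b} → T (not b) → ¬ T b
T-not⇒¬T {false} _ ()

≡-not-by-T : ∀ {a b} → (T a → ¬ T b) → (¬ T b → T a) → a ≡ not b
≡-not-by-T {true}  {true}  a⇒¬b _   = ⊥-elim (a⇒¬b tt tt)
≡-not-by-T {true}  {false} _    _   = refl
≡-not-by-T {false} {true}  _    _   = refl
≡-not-by-T {false} {false} _    ¬b⇒a = ⊥-elim (¬b⇒a id)

module _ {n : ℕ} where

  ==⇒≡ : {a b : Fin n} → (a == b) ≡ true → a ≡ b
  ==⇒≡ eq = toWitness (from T-≡ eq)

  ==-refl : (a : Fin n) → (a == a) ≡ true
  ==-refl a = to T-≡ (fromWitness refl)

  ==-sym : (a b : Fin n) → (a == b) ≡ (b == a)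
  ==-sym a b with a ≟ b | b ≟ a
  ... | yes _   | yes _   = refl
  ... | no _    | no _    = refl
  ... | yes a≡b | no b≢a  = ⊥-elim (b≢a (sym a≡b))
  ... | no a≢b  | yes b≡a = ⊥-elim (a≢b (sym b≡a))

  anyV-sound : {p : Fin n → Bool} → T (anyV p) → ∃ λ x → T (p x)
  anyV-sound {p} h = satisfied (any⁻ p (allFin n) h)

  anyV-complete : {p : Fin n → Bool} (x : Fin n) → T (p x) → T (anyV p)
  anyV-complete {p} x h = any⁺ p (lose (∈-allFin x) h)

module _ {n : ℕ} (f : Fin n → Fin n) where

  iter-+ : ∀ a b x → iter f (a + b) x ≡ iter f a (iter f b x)
  iter-+ zero    b x = refl
  iter-+ (suc a) b x = cong f (iter-+ a b x)

  iter-suc : ∀ k x → iter f (suc k) x ≡ iter f k (f x)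
  iter-suc zero    x = refl
  iter-suc (suc k) x = cong f (iter-suc k x)

  iter-fixed : ∀ {r} → f r ≡ r → ∀ k → iter f k r ≡ r
  iter-fixed fr zero    = refl
  iter-fixed fr (suc k) = trans (cong f (iter-fixed fr k)) fr

  -- Among x, f x, …, fⁿ x two points coincide, so a longer orbit segment can be shortened.
  iter-bounded : ∀ {x y} K → iter f K x ≡ y → ∃ λ k → k ≤ n × iter f k x ≡ y
  iter-bounded {x} {y} K = shorten K (<-wellFounded K)
    where
    shorten : ∀ K → Acc _<_ K → iter f K x ≡ y → ∃ λ k → k ≤ n × iter f k x ≡ y
    shorten K (acc rec) fᴷx≡y with K ≤? n
    ... | yes K≤n = K , K≤n , fᴷx≡y
    ... | no  K≰n
      with i , j , i<j , fⁱx≡fʲx ← pigeonhole (n<1+n n) (λ k → iter f (toℕ k) x) =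
      shorten K′ (rec K′<K) fᴷ′x≡y
      where
      j≤K : toℕ j ≤ K
      j≤K = ≤-trans (≤-pred (toℕ<n j)) (<⇒≤ (≰⇒> K≰n))
      K′ = (K ∸ toℕ j) + toℕ i
      K′<K : K′ < K
      K′<K = subst (K′ <_) (m∸n+n≡m j≤K) (+-monoʳ-< (K ∸ toℕ j) i<j)
      fᴷ′x≡y : iter f K′ x ≡ y
      fᴷ′x≡y = begin
        iter f ((K ∸ toℕ j) + toℕ i) x     ≡⟨ iter-+ (K ∸ toℕ j) (toℕ i) x ⟩
        iter f (K ∸ toℕ j) (iter f (toℕ i) x) ≡⟨ cong (iter f (K ∸ toℕ j)) fⁱx≡fʲx ⟩
        iter f (K ∸ toℕ j) (iter f (toℕ j) x) ≡⟨ sym (iter-+ (K ∸ toℕ j) (toℕ j) x) ⟩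
        iter f ((K ∸ toℕ j) + toℕ j) x     ≡⟨ cong (λ k → iter f k x) (m∸n+n≡m j≤K) ⟩
        iter f K x                         ≡⟨ fᴷx≡y ⟩
        y                                  ∎

module _ {n : ℕ} (par : Fin n → Fin n) where

  InSub : Fin n → Fin n → Set
  InSub v u = ∃ λ k → iter par k u ≡ v

  inSub-sound : ∀ {v u} → T (inSub par v u) → InSub v u
  inSub-sound {v} {u} h with k , p ← satisfied (any⁻ (λ k → iter par k u == v) (upTo (suc n)) h) = k , toWitness p

  inSub-complete : ∀ {v u} → InSub v u → T (inSub par v u)
  inSub-complete {v} {u} (K , eq) with k , k≤n , eq′ ← iter-bounded par K eq =
    any⁺ (λ k → iter par k u == v) (lose (∈-upTo⁺ (s≤s k≤n)) (fromWitness eq′))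

  InSub-parent : ∀ {v u} → InSub v (par u) → InSub v u
  InSub-parent {u = u} (k , eq) = suc k , trans (iter-suc par k u) eq

  InSub-climb : ∀ {v u} → InSub v u → u ≢ v → InSub v (par u)
  InSub-climb         (zero  , u≡v) u≢v = ⊥-elim (u≢v u≡v)
  InSub-climb {u = u} (suc k , eq)  _   = k , trans (sym (iter-suc par k u)) eq

  ¬InSub-root : ∀ {r v} → par r ≡ r → v ≢ r → ¬ InSub v r
  ¬InSub-root par-r v≢r (k , eq) = v≢r (trans (sym eq) (iter-fixed par par-r k))

module _ {n : ℕ} (adj : Adj n) (simple : SimpleGraph adj) where

  private
    adj-sym = proj₁ simple
    adj-irrefl = proj₂ simple

    edge< : Fin n → Fin n → ℕ
    edge< i j = if (toℕ i <ᵇ toℕ j) ∧ adj i j then 1 else 0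

  adjacent⇒≢ : ∀ {i j} → adj i j ≡ true → i ≢ j
  adjacent⇒≢ {i} e refl with () ← trans (sym e) (adj-irrefl i)

  adj-split : ∀ i j → (if adj i j then 1 else 0) ≡ edge< i j + edge< j i
  adj-split i j rewrite adj-sym j i with adj i j in e
  ... | false rewrite ∧-zeroʳ (toℕ i <ᵇ toℕ j) | ∧-zeroʳ (toℕ j <ᵇ toℕ i) = refl
  ... | true rewrite ∧-identityʳ (toℕ i <ᵇ toℕ j) | ∧-identityʳ (toℕ j <ᵇ toℕ i)
    with toℕ i <ᵇ toℕ j | <ᵇ-reflects-< (toℕ i) (toℕ j) | toℕ j <ᵇ toℕ i | <ᵇ-reflects-< (toℕ j) (toℕ i)
  ...   | _ | ofʸ i<j | _ | ofʸ j<i = ⊥-elim (<-asym i<j j<i)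
  ...   | _ | ofʸ _   | _ | ofⁿ _   = refl
  ...   | _ | ofⁿ _   | _ | ofʸ _   = refl
  ...   | _ | ofⁿ i≮j | _ | ofⁿ j≮i = ⊥-elim (adjacent⇒≢ e (toℕ-injective (≤-antisym (≮⇒≥ j≮i) (≮⇒≥ i≮j))))

  degree-sum : sumV (deg adj) ≡ 2 * numEdges adj
  degree-sum = begin
    sumV (λ i → sumV (λ j → if adj i j then 1 else 0))   ≡⟨ sumV-cong (λ i → sumV-cong (adj-split i)) ⟩
    sumV (λ i → sumV (λ j → edge< i j + edge< j i))      ≡⟨ sumV-cong (λ i → sumV-distrib-+ (edge< i) (λ j → edge< j i)) ⟩
    sumV (λ i → sumV (edge< i) + sumV (λ j → edge< j i)) ≡⟨ sumV-distrib-+ (λ i → sumV (edge< i)) _ ⟩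
    numEdges adj + sumV (λ i → sumV (λ j → edge< j i))   ≡⟨ cong (numEdges adj +_) (sumV-comm (λ i j → edge< j i)) ⟩
    numEdges adj + numEdges adj                          ≡⟨ cong (numEdges adj +_) (sym (+-identityʳ _)) ⟩
    2 * numEdges adj                                     ∎

  vol-not : (S : Fin n → Bool) → vol adj (not ∘ S) ≡ 2 * numEdges adj ∸ vol adj S
  vol-not S = begin
    vol adj (not ∘ S)                          ≡⟨ sym (m+n∸m≡n (vol adj S) _) ⟩
    vol adj S + vol adj (not ∘ S) ∸ vol adj S  ≡⟨ cong (_∸ vol adj S) partition ⟩
    2 * numEdges adj ∸ vol adj S               ∎
    where
    split : ∀ v → (if S v then deg adj v else 0) + (if not (S v) then deg adj v else 0) ≡ deg adj v
    split v with S v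
    ... | true  = +-identityʳ (deg adj v)
    ... | false = refl

    partition : vol adj S + vol adj (not ∘ S) ≡ 2 * numEdges adj
    partition = trans (sym (sumV-distrib-+ {n} _ _)) (trans (sumV-cong split) degree-sum)

SamePair : {A : Set} → A → A → A → A → Set
SamePair a b i j = (a ≡ i × b ≡ j) ⊎ (a ≡ j × b ≡ i)

module _ {n : ℕ} where

  samePair-sound : {a b i j : Fin n} → T ((a == i ∧ b == j) ∨ (a == j ∧ b == i)) → SamePair a b i j
  samePair-sound {a} {b} {i} {j} h with to (T-∨ {a == i ∧ b == j}) h
  ... | inj₁ h₁ = let a≡i , b≡j = to (T-∧ {a == i}) h₁ in inj₁ (toWitness a≡i , toWitness b≡j)
  ... | inj₂ h₂ = let a≡j , b≡i = to (T-∧ {a == j}) h₂ in inj₂ (toWitness a≡j , toWitness b≡i)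

  samePair-complete : {a b i j : Fin n} → SamePair a b i j → T ((a == i ∧ b == j) ∨ (a == j ∧ b == i))
  samePair-complete {a} {b} (inj₁ (refl , refl)) rewrite ==-refl a | ==-refl b = tt
  samePair-complete {a} {b} (inj₂ (refl , refl))
    rewrite ==-refl a | ==-refl b | ∨-zeroʳ (a == b ∧ b == a) = tt

  samePair-meets : {a b c d i j : Fin n} → SamePair a b i j → SamePair c d i j → c ≡ a ⊎ c ≡ b
  samePair-meets (inj₁ (refl , refl)) (inj₁ (refl , _)) = inj₁ refl
  samePair-meets (inj₁ (refl , refl)) (inj₂ (refl , _)) = inj₂ refl
  samePair-meets (inj₂ (refl , refl)) (inj₁ (refl , _)) = inj₂ refl
  samePair-meets (inj₂ (refl , refl)) (inj₂ (refl , _)) = inj₁ refl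

module CutEdge {n : ℕ} (r : Fin n) (par : Fin n → Fin n) (par-r : par r ≡ r)
  (reaches-r : ∀ v → ∃ λ k → iter par k v ≡ r)
  (c : Fin n) (c≢r : c ≢ r) {i j : Fin n} (cut : SamePair c (par c) i j) where

  forest-edge⁻ : ∀ {a b} → T (forestAdj r par i j a b) → (par a ≡ b × a ≢ c) ⊎ par b ≡ a
  forest-edge⁻ {a} {b} h with to (T-∧ {treeEdge r par a b}) h
  ... | tree , uncut with to (T-∨ {not (a == r) ∧ (par a == b)}) tree
  ...   | inj₁ up = inj₁ (pa≡b , a≢c)
    where
    pa≡b : par a ≡ b
    pa≡b = toWitness (proj₂ (to (T-∧ {not (a == r)}) up))
    a≢c : a ≢ c
    a≢c refl = T-not⇒¬T uncut (samePair-complete (subst (λ x → SamePair c x i j) pa≡b cut))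
  ...   | inj₂ down = inj₂ (toWitness (proj₂ (to (T-∧ {not (b == r)}) down)))

  forest-edge⁺ : ∀ {a} → a ≢ r → a ≢ c → par a ≢ c → T (forestAdj r par i j a (par a))
  forest-edge⁺ {a} a≢r a≢c pa≢c = from (T-∧ {treeEdge r par a (par a)}) (tree , ¬T⇒T-not uncut)
    where
    tree : T (treeEdge r par a (par a))
    tree = from (T-∨ {not (a == r) ∧ (par a == par a)})
      (inj₁ (from (T-∧ {not (a == r)}) (fromWitnessFalse a≢r , fromWitness refl)))
    uncut : ¬ T ((a == i ∧ par a == j) ∨ (a == j ∧ par a == i))
    uncut h with samePair-meets (samePair-sound h) cut
    ... | inj₁ c≡a  = a≢c (sym c≡a)
    ... | inj₂ c≡pa = pa≢c (sym c≡pa)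

  reach⇒¬InSub : ∀ k w → T (reachR r par i j k w) → ¬ InSub par c w
  reach⇒¬InSub zero w h with refl ← toWitness h = ¬InSub-root par par-r c≢r
  reach⇒¬InSub (suc k) w h with to (T-∨ {reachR r par i j k w}) h
  ... | inj₁ h′ = reach⇒¬InSub k w h′
  ... | inj₂ h′
    with x , hx ← anyV-sound h′
    with edge , x-reaches ← to (T-∧ {forestAdj r par i j w x}) hx
    with forest-edge⁻ {w} {x} edge
  ...   | inj₁ (refl , w≢c) = λ w∈ → reach⇒¬InSub k x x-reaches (InSub-climb par w∈ w≢c)
  ...   | inj₂ refl         = λ w∈ → reach⇒¬InSub k x x-reaches (InSub-parent par w∈)

  reach-suc : ∀ k w → T (reachR r par i j k w) → T (reachR r par i j (suc k) w)
  reach-suc k w h = from (T-∨ {reachR r par i j k w}) (inj₁ h)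

  reach-step : ∀ k w x → T (forestAdj r par i j w x) → T (reachR r par i j k x) → T (reachR r par i j (suc k) w)
  reach-step k w x edge h = from (T-∨ {reachR r par i j k w})
    (inj₂ (anyV-complete x (from (T-∧ {forestAdj r par i j w x}) (edge , h))))

  reach-+ : ∀ d k w → T (reachR r par i j k w) → T (reachR r par i j (d + k) w)
  reach-+ zero    k w h = h
  reach-+ (suc d) k w h = reach-suc (d + k) w (reach-+ d k w h)

  ¬InSub⇒reach : ∀ k w → iter par k w ≡ r → ¬ InSub par c w → T (reachR r par i j k w)
  ¬InSub⇒reach zero    w w≡r _ = fromWitness w≡r
  ¬InSub⇒reach (suc k) w eq w∉ = by-cases (w ≟ r)
    where
    w≢c : w ≢ c
    w≢c refl = w∉ (0 , refl)
    pw≢c : par w ≢ c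
    pw≢c pw≡c = w∉ (1 , pw≡c)

    by-cases : Dec (w ≡ r) → T (reachR r par i j (suc k) w)
    by-cases (yes refl) = reach-suc k w (¬InSub⇒reach k w (iter-fixed par par-r k) w∉)
    by-cases (no w≢r)   = reach-step k w (par w) (forest-edge⁺ w≢r w≢c pw≢c)
      (¬InSub⇒reach k (par w) (trans (sym (iter-suc par k w)) eq) (w∉ ∘ InSub-parent par))

  T₁-complement : ∀ w → T₁ r par i j w ≡ not (inSub par c w)
  T₁-complement w = ≡-not-by-T (λ h w∈ → reach⇒¬InSub n w h (inSub-sound par w∈)) reach
    where
    reach : ¬ T (inSub par c w) → T (T₁ r par i j w)
    reach w∉ with k , k≤n , eq ← uncurry (iter-bounded par) (reaches-r w) =
      subst (λ m → T (reachR r par i j m w)) (m∸n+n≡m k≤n)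
        (reach-+ (n ∸ k) k w (¬InSub⇒reach k w eq (w∉ ∘ inSub-complete par)))

  vol-T₁ : (adj : Adj n) → SimpleGraph adj → vol adj (T₁ r par i j) ≡ 2 * numEdges adj ∸ vol adj (inSub par c)
  vol-T₁ adj simple =
    trans (sumV-cong (λ w → cong (λ b → if b then deg adj w else 0) (T₁-complement w)))
          (vol-not adj simple (inSub par c))

module _ {n : ℕ} {r : Fin n} (par : Fin n → Fin n) where

  onPath-parent : ∀ {u i j} → T (onPath r par u i j) → j ≡ par i
  onPath-parent {u} {i} {j} h =
    sym (toWitness (proj₁ (to (T-∧ {par i == j}) (proj₂ (to (T-∧ {not (i == r)}) h)))))

  onPath-to-parent : ∀ u i → onPath r par u i (par i) ≡ not (i == r) ∧ inSub par i u
  onPath-to-parent u i = cong (λ b → not (i == r) ∧ (b ∧ inSub par i u)) (==-refl (par i))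

  sumV-onPath : ∀ u i (P : Fin n → Bool) (g : Fin n → ℕ) →
    sumV (λ j → if P j ∧ onPath r par u i j then g j else 0)
      ≡ (if P (par i) ∧ onPath r par u i (par i) then g (par i) else 0)
  sumV-onPath u i P g = sumV-single _ (par i)
    (λ j j≢pi → if-vanishes (g j) (j≢pi ∘ onPath-parent ∘ proj₂ ∘ to (T-∧ {P j})))

module ForestVolumeSums {n : ℕ} (adj : Adj n) (simple : SimpleGraph adj) (r : Fin n) (par par₀ : Fin n → Fin n)
  (par-r : par r ≡ r) (reaches-r : ∀ v → ∃ λ k → iter par k v ≡ r) (par₀-r : par₀ r ≡ r) where

  rootSideVol : Fin n → ℕ
  rootSideVol v = 2 * numEdges adj ∸ vol adj (inSub par v)

  vol-cut-child : ∀ v → v ≢ r → vol adj (T₁ r par v (par v)) ≡ rootSideVol v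
  vol-cut-child v v≢r = CutEdge.vol-T₁ r par par-r reaches-r v v≢r (inj₁ (refl , refl)) adj simple

  vol-cut-parent : ∀ v → v ≢ r → vol adj (T₁ r par (par v) v) ≡ rootSideVol v
  vol-cut-parent v v≢r = CutEdge.vol-T₁ r par par-r reaches-r v v≢r (inj₂ (refl , refl)) adj simple

  guard-≢r : ∀ v q t → T ((not (v == r) ∧ q) ∧ t) → v ≢ r
  guard-≢r v q t h = toWitnessFalse (proj₁ (to (T-∧ {not (v == r)}) (proj₁ (to (T-∧ {not (v == r) ∧ q}) h))))

  root-term : ∀ v q t → (if (not (v == r) ∧ q) ∧ (inSub par v r ∧ t) then rootSideVol v else 0) ≡ 0
  root-term v q t = if-vanishes (rootSideVol v) λ h →
    ¬InSub-root par par-r (guard-≢r v q _ h)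
      (inSub-sound par (proj₁ (to (T-∧ {inSub par v r}) (proj₂ (to (T-∧ {not (v == r) ∧ q}) h)))))

  guard₁ : ∀ u v → onPath r par₀ u v (par v) ∧ onPath r par u v (par v)
    ≡ (not (v == r) ∧ (par v == par₀ v)) ∧ (inSub par v u ∧ inSub par₀ v u)
  guard₁ u v = begin
    onPath r par₀ u v (par v) ∧ onPath r par u v (par v)
      ≡⟨ cong₂ _∧_ (cong (λ b → not (v == r) ∧ (b ∧ inSub par₀ v u)) (==-sym (par₀ v) (par v)))
                   (onPath-to-parent par u v) ⟩
    (not (v == r) ∧ (par v == par₀ v) ∧ inSub par₀ v u) ∧ (not (v == r) ∧ inSub par v u)
      ≡⟨ ∧-shuffle (not (v == r)) _ _ (inSub par₀ v u) (inSub par v u) (λ v≢r _ → v≢r) ⟩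
    (not (v == r) ∧ (par v == par₀ v)) ∧ (inSub par v u ∧ inSub par₀ v u) ∎

  guard₂ : ∀ u v → onPath r par₀ u (par v) v ∧ onPath r par u v (par v)
    ≡ (not (v == r) ∧ (par₀ (par v) == v)) ∧ (inSub par v u ∧ inSub par₀ (par v) u)
  guard₂ u v = begin
    onPath r par₀ u (par v) v ∧ onPath r par u v (par v)
      ≡⟨ cong (onPath r par₀ u (par v) v ∧_) (onPath-to-parent par u v) ⟩
    (not (par v == r) ∧ (par₀ (par v) == v) ∧ inSub par₀ (par v) u) ∧ (not (v == r) ∧ inSub par v u)
      ≡⟨ ∧-shuffle (not (v == r)) _ (not (par v == r)) (inSub par₀ (par v) u) (inSub par v u) pv≢r ⟩
    (not (v == r) ∧ (par₀ (par v) == v)) ∧ (inSub par v u ∧ inSub par₀ (par v) u) ∎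
    where
    pv≢r : T (not (v == r)) → T (par₀ (par v) == v) → T (not (par v == r))
    pv≢r v≢r p₀pv≡v = fromWitnessFalse λ pv≡r →
      toWitnessFalse v≢r (trans (sym (toWitness p₀pv≡v)) (trans (cong par₀ pv≡r) par₀-r))

  term₁ : ∀ u v →
    (if not (u == r) then sumV (λ j → if onPath r par₀ u v j ∧ onPath r par u v j then vol adj (T₁ r par v j) else 0) else 0)
      ≡ (if (not (v == r) ∧ (par v == par₀ v)) ∧ (inSub par v u ∧ inSub par₀ v u) then rootSideVol v else 0)
  term₁ u v with u == r in u=r
  ... | true rewrite ==⇒≡ u=r = sym (root-term v _ _)
  ... | false = trans (sumV-onPath par u v (onPath r par₀ u v) _)
                      (if-cong (guard₁ u v) (vol-cut-child v ∘ guard-≢r v _ _))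

  term₂ : ∀ u v →
    (if not (u == r) then sumV (λ i → if onPath r par₀ u i v ∧ onPath r par u v i then vol adj (T₁ r par i v) else 0) else 0)
      ≡ (if (not (v == r) ∧ (par₀ (par v) == v)) ∧ (inSub par v u ∧ inSub par₀ (par v) u) then rootSideVol v else 0)
  term₂ u v with u == r in u=r
  ... | true rewrite ==⇒≡ u=r = sym (root-term v _ _)
  ... | false = trans (sumV-onPath par u v (λ i → onPath r par₀ u i v) _)
                      (if-cong (guard₂ u v) (vol-cut-parent v ∘ guard-≢r v _ _))

  part₁ : sumV (λ u → if not (u == r) then sumFP adj r par par₀ u else 0)
    ≡ sumV (λ v → if not (v == r) ∧ (par v == par₀ v)
        then sumV (λ u → if inSub par v u ∧ inSub par₀ v u then rootSideVol v else 0) else 0)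
  part₁ = sumV-regroup (λ u → not (u == r)) _ _ _ rootSideVol term₁

  part₂ : sumV (λ u → if not (u == r) then sumFP' adj r par par₀ u else 0)
    ≡ sumV (λ v → if not (v == r) ∧ (par₀ (par v) == v)
        then sumV (λ u → if inSub par v u ∧ inSub par₀ (par v) u then rootSideVol v else 0) else 0)
  part₂ = trans (sumV-cong (λ u → cong (λ s → if not (u == r) then s else 0) (sumV-comm {n} _)))
                (sumV-regroup (λ u → not (u == r)) _ _ _ rootSideVol term₂)

mainTheorem4 : ∀ {n : ℕ} (adj : Adj n) (r : Fin n) (par par₀ : Fin n → Fin n) →
    SimpleGraph adj → Connected adj →
    RootedSpanningTree adj r par → RootedSpanningTree adj r par₀ →
    (sumV (λ u → if not (u == r) then sumFP adj r par par₀ u else 0)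
      ≡ sumV (λ v → if not (v == r) ∧ (par v == par₀ v)
          then sumV (λ u → if inSub par v u ∧ inSub par₀ v u
            then 2 * numEdges adj ∸ vol adj (inSub par v) else 0)
          else 0))
    ×
    (sumV (λ u → if not (u == r) then sumFP' adj r par par₀ u else 0)
      ≡ sumV (λ v → if not (v == r) ∧ (par₀ (par v) == v)
          then sumV (λ u → if inSub par v u ∧ inSub par₀ (par v) u
            then 2 * numEdges adj ∸ vol adj (inSub par v) else 0)
          else 0))
mainTheorem4 adj r par par₀ simple _ (par-r , _ , reaches-r) (par₀-r , _ , _) = part₁ , part₂
  where open ForestVolumeSums adj simple r par par₀ par-r reaches-r par₀-r
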